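{- Let $T_{n+1}$ be a tree of order $n+1\geq 2$. Then $\sigma^{ - }(T_{n+1})\leq \left\lfloor \frac{C(T_{n+1})}{2}\right\rfloor +1$.
   Context: For a connected simple graph $G$ of order $p$, a parity labelling is a bijection $f:V(G)\to\{1,\ldots,p\}$; an edge $uv$ is negative if $f(u),f(v)$ have opposite parity. The rna number $\sigma^{ - }(G)$ is the minimum over all such $f$ of the number of negative edges. For a tree $T$, $C(T)$ is the minimum of $\big||S_1|-|S_2|\big|$ over all partitions of $V(T)$ into two nonempty sets $S_1,S_2$ such that the induced subgraphs $\langle S_1\rangle$ and $\langle S_2\rangle$ are both connected. -}

module Defs where

open import Data.Bool using (Bool; true; false; not; _∧_; if_then_else_)
open import Data.Nat using (ℕ; zero; suc; _≤_; _<ᵇ_; ∣_-_∣)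
open import Data.Fin using (Fin; toℕ)
open import Data.Fin.Subset using (Subset; _∈_; ∁; ∣_∣; Nonempty)
open import Data.Fin.Permutation using (Permutation′; _⟨$⟩ʳ_)
open import Data.List using (List; []; _∷_; _++_; [_]; length; filterᵇ; cartesianProduct; allFin)
open import Data.List.Relation.Unary.Linked using (Linked)
open import Data.List.Relation.Unary.Unique.Propositional using (Unique)
open import Data.Product using (Σ; ∃; _×_; _,_; proj₁; proj₂)
open import Relation.Binary.PropositionalEquality using (_≡_)
open import Relation.Nullary using (¬_)

record Graph (p : ℕ) : Set where
  field
    adj   : Fin p → Fin p → Bool
    sym   : ∀ u v → adj u v ≡ adj v u
    irrefl : ∀ u → adj u u ≡ false

module _ {p : ℕ} (G : Graph p) where
  open Graph G

  Adj : Fin p → Fin p → Set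
  Adj u v = adj u v ≡ true

  data Walk (R : Fin p → Fin p → Set) : Fin p → Fin p → Set where
    here : ∀ {u} → Walk R u u
    step : ∀ {u v w} → R u v → Walk R v w → Walk R u w

  Connected : Set
  Connected = ∀ u v → Walk Adj u v

  HasCycle : Set
  HasCycle = Σ (Fin p) λ v → Σ (List (Fin p)) λ vs →
    (2 ≤ length vs) × Unique (v ∷ vs) × Linked Adj (v ∷ vs ++ [ v ])

  IsTree : Set
  IsTree = Connected × ¬ HasCycle

  InducedConnected : Subset p → Set
  InducedConnected S =
    ∀ u v → u ∈ S → v ∈ S → Walk (λ x y → (x ∈ S) × (y ∈ S) × Adj x y) u v

  ConnectedPartition : Subset p → Set
  ConnectedPartition S = Nonempty S × Nonempty (∁ S)
    × InducedConnected S × InducedConnected (∁ S)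

  IsC : ℕ → Set
  IsC c = (Σ (Subset p) λ S → ConnectedPartition S × ∣ ∣ S ∣ - ∣ ∁ S ∣ ∣ ≡ c)
        × (∀ S → ConnectedPartition S → c ≤ ∣ ∣ S ∣ - ∣ ∁ S ∣ ∣)

  -- parity labelling: bijection V → {1,…,p}, v ↦ 1 + π v
  label : Permutation′ p → Fin p → ℕ
  label π v = suc (toℕ (π ⟨$⟩ʳ v))

  odd : ℕ → Bool
  odd zero = false
  odd (suc n) = not (odd n)

  -- u < v (each edge counted once), uv an edge, labels of opposite parity
  negativeB : Permutation′ p → Fin p × Fin p → Bool
  negativeB π (u , v) = (toℕ u <ᵇ toℕ v) ∧ adj u v
    ∧ (if odd (label π u) then not (odd (label π v)) else odd (label π v))

  negEdges : Permutation′ p → ℕ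
  negEdges π = length (filterᵇ (negativeB π) (cartesianProduct (allFin p) (allFin p)))

  IsRna : ℕ → Set
  IsRna s = (∃ λ π → negEdges π ≡ s) × (∀ π → s ≤ negEdges π)

-- Let S, ∁S be a connected partition realising C(T), and colour the smaller side. In a tree exactly
-- one edge joins S and ∁S (two of them, joined by paths inside S and inside ∁S, would close a cycle),
-- so this colouring has one cut edge. Adding to the colour class a leaf of the forest spanned by the
-- uncoloured vertices creates at most one new cut edge; after ⌊ C(T) /2⌋ such steps the class has
-- ⌊ p /2⌋ vertices and at most ⌊ C(T) /2⌋ + 1 cut edges. Every ⌊ p /2⌋-set is the set of even labels
-- of some labelling, and the negative edges of that labelling are exactly the cut edges of the set.
module Submission where

open import Defs
open import Data.Nat using (ℕ; suc; _≤_; _+_; _/_)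

open import Data.Bool using (Bool; true; false; not; _∧_; _∨_; _xor_; if_then_else_; T)
import Data.Bool.Properties as Bool
open import Data.Nat using (zero; _<_; _⊓_; z≤n; s≤s; s<s⁻¹; _<ᵇ_; ⌊_/2⌋; ∣_-_∣)
open import Data.Nat.DivMod using (m/n≡1+[m∸n]/n)
open import Data.Nat.Properties hiding (_≟_)
open import Algebra.Properties.CommutativeMonoid.Sum +-0-commutativeMonoid
  using (sum; sum-cong-≗; sum-permute)
open import Data.Fin using (Fin; zero; suc; toℕ; _≟_)
open import Data.Fin.Properties using (any?)
open import Data.Fin.Subset using (Subset; ∁; ∣_∣) renaming (_∈_ to _∈ₛ_)
open import Data.Fin.Subset.Properties using (∣p∣≤n; ∣∁p∣≡n∸∣p∣; x∈p⇒x∉∁p)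
open import Data.Vec using (lookup) renaming ([] to []ᵥ; _∷_ to _∷ᵥ_)
open import Data.Vec.Properties using (lookup⇒[]=; lookup-map)
open import Data.Fin.Permutation using (Permutation′; _⟨$⟩ʳ_; _∘ₚ_; lift₀; transpose) renaming (id to idₚ)
open import Data.List using (List; []; _∷_; _++_; [_]; length; filterᵇ; cartesianProduct; allFin)
open import Data.List.Properties using (filter-≐; length-++)
open import Data.List.Membership.Propositional using (_∈_)
open import Data.List.Relation.Binary.Subset.Propositional using (_⊆_)
open import Data.List.Relation.Unary.Any using (here; there)
open import Data.List.Relation.Unary.Linked using (Linked; [-]; _∷_)
import Data.List.Membership.DecPropositional as DecMembership
open import Data.List.Relation.Unary.All as All using (All; []; _∷_)
open import Data.List.Relation.Unary.All.Properties using (All¬⇒¬Any; ¬Any⇒All¬; all-filter; anti-mono)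
open import Data.List.Relation.Unary.Unique.Propositional using (Unique)
open import Data.List.Relation.Unary.Unique.Propositional.Properties
  using (filter⁺; ++⁺; cartesianProduct⁺; allFin⁺)
open import Data.List.Relation.Unary.AllPairs using ([]; _∷_)
open import Data.Product using (∃; ∃₂; _×_; _,_; proj₁; proj₂; map; swap)
open import Data.Sum using (_⊎_; inj₁; inj₂)
open import Function using (_∘_; id; Equivalence)
open import Relation.Binary.PropositionalEquality hiding ([_])
open import Relation.Nullary using (¬_; yes; no; contradiction)
open import Relation.Nullary.Decidable using (does; dec-true; dec-false; T?; ¬?; _×-dec_; decidable-stable)
open import Relation.Unary using (Decidable)

count : ∀ {n} → (Fin n → Bool) → ℕ
count f = sum (λ i → if f i then 1 else 0)

count-cong : ∀ {n} {f g : Fin n → Bool} → (∀ i → f i ≡ g i) → count f ≡ count g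
count-cong f≗g = sum-cong-≗ (λ i → cong (λ b → if b then 1 else 0) (f≗g i))

count-permute : ∀ {n} (f : Fin n → Bool) (π : Permutation′ n) → count (λ i → f (π ⟨$⟩ʳ i)) ≡ count f
count-permute f π = sym (sum-permute (λ i → if f i then 1 else 0) π)

count≤n : ∀ {n} (f : Fin n → Bool) → count f ≤ n
count≤n {zero}  f = z≤n
count≤n {suc n} f with f zero
... | true  = s≤s (count≤n (f ∘ suc))
... | false = m≤n⇒m≤1+n (count≤n (f ∘ suc))

count<n⇒∃false : ∀ {n} (f : Fin n → Bool) → count f < n → ∃ λ i → f i ≡ false
count<n⇒∃false {suc n} f lt with f zero in f₀
... | false = zero , f₀
... | true  = map suc id (count<n⇒∃false (f ∘ suc) (s<s⁻¹ lt))

0<count⇒∃true : ∀ {n} (f : Fin n → Bool) → 0 < count f → ∃ λ i → f i ≡ true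
0<count⇒∃true {suc n} f pos with f zero in f₀
... | true  = zero , f₀
... | false = map suc id (0<count⇒∃true (f ∘ suc) pos)

insert : ∀ {n} → Fin n → (Fin n → Bool) → Fin n → Bool
insert y f v = does (v ≟ y) ∨ f v

insert-self : ∀ {n} (y : Fin n) (f : Fin n → Bool) → insert y f y ≡ true
insert-self y f = cong (_∨ f y) (dec-true (y ≟ y) refl)

insert-≢ : ∀ {n} {y v : Fin n} (f : Fin n → Bool) → v ≢ y → insert y f v ≡ f v
insert-≢ {v = v} f v≢y = cong (_∨ f v) (dec-false (_ ≟ _) v≢y)

count-insert : ∀ {n} (y : Fin n) (f : Fin n → Bool) → f y ≡ false → count (insert y f) ≡ suc (count f)
count-insert zero    f fy rewrite fy = refl
count-insert (suc y) f fy =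
  trans (cong ((if f zero then 1 else 0) +_) (count-insert y (f ∘ suc) fy)) (+-suc _ _)

unique⇒length≤ : ∀ {n} {xs : List (Fin n)} → Unique xs → length xs ≤ n
unique⇒length≤ {n} uniq = ≤-trans (length≤count uniq) (count≤n _)
  where
  open DecMembership (_≟_ {n}) using (_∈?_)
  length≤count : ∀ {xs : List (Fin n)} → Unique xs → length xs ≤ count (λ v → does (v ∈? xs))
  length≤count [] = z≤n
  length≤count {xs = x ∷ xs} (x∉xs ∷ uniq) =
    ≤-trans (s≤s (length≤count uniq))
            (≤-reflexive (sym (count-insert x _ (dec-false (x ∈? xs) (All¬⇒¬Any x∉xs)))))

index-matching-head : ∀ {n} (f g : Fin (suc n) → Bool) → count f ≡ count g → ∃ λ i → f i ≡ g zero
index-matching-head {n} f g eq with g zero in g₀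
... | true  = 0<count⇒∃true f (subst (0 <_) (sym eq) (s≤s z≤n))
... | false = count<n⇒∃false f (subst (_< suc n) (sym eq) (s≤s (count≤n (g ∘ suc))))

sameCount⇒permutation : ∀ {n} (f g : Fin n → Bool) → count f ≡ count g →
                        ∃ λ (π : Permutation′ n) → ∀ v → f (π ⟨$⟩ʳ v) ≡ g v
sameCount⇒permutation {zero}  f g _  = idₚ , λ ()
sameCount⇒permutation {suc n} f g eq = lift₀ σ ∘ₚ transpose zero i , matches
  where
  i : Fin (suc n)
  i = proj₁ (index-matching-head f g eq)
  fi : f i ≡ g zero
  fi = proj₂ (index-matching-head f g eq)
  h : Fin (suc n) → Bool
  h v = f (transpose zero i ⟨$⟩ʳ v)
  tails-count : count (h ∘ suc) ≡ count (g ∘ suc)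
  tails-count = +-cancelˡ-≡ (if g zero then 1 else 0) _ _ (begin
    (if g zero then 1 else 0) + count (h ∘ suc) ≡⟨ cong (λ b → (if b then 1 else 0) + count (h ∘ suc)) (sym fi) ⟩
    count h                                     ≡⟨ count-permute f (transpose zero i) ⟩
    count f                                     ≡⟨ eq ⟩
    count g                                     ∎)
    where open ≡-Reasoning
  tails : ∃ λ (σ : Permutation′ n) → ∀ v → h (suc (σ ⟨$⟩ʳ v)) ≡ g (suc v)
  tails = sameCount⇒permutation (h ∘ suc) (g ∘ suc) tails-count
  σ : Permutation′ n
  σ = proj₁ tails
  matches : ∀ v → f ((lift₀ σ ∘ₚ transpose zero i) ⟨$⟩ʳ v) ≡ g v
  matches zero    = fi
  matches (suc v) = proj₂ tails v

count-lookup : ∀ {n} (S : Subset n) → count (lookup S) ≡ ∣ S ∣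
count-lookup []ᵥ          = refl
count-lookup (true ∷ᵥ S)  = cong suc (count-lookup S)
count-lookup (false ∷ᵥ S) = count-lookup S

lookup≡true⇒∈ : ∀ {n} (S : Subset n) {x} → lookup S x ≡ true → x ∈ₛ S
lookup≡true⇒∈ S = lookup⇒[]= _ S

lookup≡false⇒∈∁ : ∀ {n} (S : Subset n) {x} → lookup S x ≡ false → x ∈ₛ ∁ S
lookup≡false⇒∈∁ S {x} Sx = lookup⇒[]= x (∁ S) (trans (lookup-map x not S) (cong not Sx))

∣S∣+∣∁S∣≡n : ∀ {n} (S : Subset n) → ∣ S ∣ + ∣ ∁ S ∣ ≡ n
∣S∣+∣∁S∣≡n S = trans (cong (∣ S ∣ +_) (∣∁p∣≡n∸∣p∣ S)) (m+[n∸m]≡n (∣p∣≤n S))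

if-not≡xor : ∀ a b → (if a then not b else b) ≡ a xor b
if-not≡xor true  b = refl
if-not≡xor false b = refl

not-xor-not : ∀ a b → not a xor not b ≡ a xor b
not-xor-not true  b = refl
not-xor-not false b = Bool.not-involutive b

T-xor : ∀ {a b} → T (a xor b) → (a ≡ true × b ≡ false) ⊎ (a ≡ false × b ≡ true)
T-xor {true}  {false} _ = inj₁ (refl , refl)
T-xor {false} {true}  _ = inj₂ (refl , refl)

T-true-xor : ∀ {a b} → a ≡ true → T (a xor b) → b ≡ false
T-true-xor {b = false} refl _ = refl

T-∧-not : ∀ {a b} → T (a ∧ not b) → T a × ¬ T b
T-∧-not {true} {false} _ = _ , λ ()

module _ {A : Set} where

  length-filterᵇ-cong : ∀ {P Q : A → Bool} → (∀ x → P x ≡ Q x) → ∀ xs →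
                        length (filterᵇ P xs) ≡ length (filterᵇ Q xs)
  length-filterᵇ-cong {P} {Q} P≗Q xs =
    cong length (filter-≐ (T? ∘ P) (T? ∘ Q) ((λ {x} → subst T (P≗Q x)) , (λ {x} → subst T (sym (P≗Q x)))) xs)

  length-filterᵇ≤ : ∀ (P Q : A → Bool) xs →
    length (filterᵇ P xs) ≤ length (filterᵇ Q xs) + length (filterᵇ (λ x → P x ∧ not (Q x)) xs)
  length-filterᵇ≤ P Q [] = z≤n
  length-filterᵇ≤ P Q (x ∷ xs) with P x | Q x
  ... | true  | true  = s≤s (length-filterᵇ≤ P Q xs)
  ... | true  | false = ≤-trans (s≤s (length-filterᵇ≤ P Q xs)) (≤-reflexive (sym (+-suc _ _)))
  ... | false | true  = m≤n⇒m≤1+n (length-filterᵇ≤ P Q xs)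
  ... | false | false = length-filterᵇ≤ P Q xs

  length-filterᵇ≤1 : ∀ (P : A → Bool) {xs} → Unique xs → (∀ {x y} → T (P x) → T (P y) → x ≡ y) →
                     length (filterᵇ P xs) ≤ 1
  length-filterᵇ≤1 P {xs} uniq P-unique = atMostOne (filter⁺ (T? ∘ P) uniq) (all-filter (T? ∘ P) xs)
    where
    atMostOne : ∀ {ys} → Unique ys → All (T ∘ P) ys → length ys ≤ 1
    atMostOne {[]}        _                _                = z≤n
    atMostOne {_ ∷ []}    _                _                = s≤s z≤n
    atMostOne {_ ∷ _ ∷ _} ((x≢y ∷ _) ∷ _) (Px ∷ Py ∷ _) = contradiction (P-unique Px Py) x≢y

⌊n/2⌋≡n/2 : ∀ n → ⌊ n /2⌋ ≡ n / 2
⌊n/2⌋≡n/2 0             = refl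
⌊n/2⌋≡n/2 1             = refl
⌊n/2⌋≡n/2 (suc (suc n)) =
  trans (cong suc (⌊n/2⌋≡n/2 n)) (sym (m/n≡1+[m∸n]/n {suc (suc n)} {2} (s≤s (s≤s z≤n))))

⊓+⌊∣-∣/2⌋≡⌊+/2⌋ : ∀ m n → m ⊓ n + ⌊ ∣ m - n ∣ /2⌋ ≡ ⌊ m + n /2⌋
⊓+⌊∣-∣/2⌋≡⌊+/2⌋ zero    n       = refl
⊓+⌊∣-∣/2⌋≡⌊+/2⌋ (suc m) zero    = cong ⌊_/2⌋ (sym (+-identityʳ (suc m)))
⊓+⌊∣-∣/2⌋≡⌊+/2⌋ (suc m) (suc n) =
  trans (cong suc (⊓+⌊∣-∣/2⌋≡⌊+/2⌋ m n)) (cong (⌊_/2⌋ ∘ suc) (sym (+-suc m n)))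

module _ {p : ℕ} (G : Graph p) where
  open Graph G using (adj; irrefl) renaming (sym to adj-sym)
  open DecMembership (_≟_ {p}) using (_∈?_)

  Adj-sym : ∀ {u v} → Adj G u v → Adj G v u
  Adj-sym {u} {v} u~v = trans (adj-sym v u) u~v

  Adj-irrefl : ∀ {u} → ¬ Adj G u u
  Adj-irrefl {u} u~u with () ← trans (sym (irrefl u)) u~u

  module _ {R : Fin p → Fin p → Set} where

    vertices : ∀ {u v} → Walk G R u v → List (Fin p)
    vertices {u} here       = u ∷ []
    vertices {u} (step _ w) = u ∷ vertices w

    0<length-vertices : ∀ {u v} (w : Walk G R u v) → 0 < length (vertices w)
    0<length-vertices here       = s≤s z≤n
    0<length-vertices (step _ _) = s≤s z≤n

    2≤length-vertices : ∀ {u v} → u ≢ v → (w : Walk G R u v) → 2 ≤ length (vertices w)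
    2≤length-vertices u≢u here              = contradiction refl u≢u
    2≤length-vertices _   (step _ here)     = s≤s (s≤s z≤n)
    2≤length-vertices _   (step _ (step _ _)) = s≤s (s≤s z≤n)

    Path : Fin p → Fin p → Set
    Path u v = ∃ λ (w : Walk G R u v) → Unique (vertices w)

    dropTo : ∀ {u v x} (w : Walk G R u v) → Unique (vertices w) → x ∈ vertices w → Path x v
    dropTo here       uniq       (here refl)  = here , uniq
    dropTo (step r w) uniq       (here refl)  = step r w , uniq
    dropTo (step _ w) (_ ∷ uniq) (there x∈w) = dropTo w uniq x∈w

    takeTo : ∀ {u v x} (w : Walk G R u v) → Unique (vertices w) → x ∈ vertices w →
             ∃ λ ((w′ , _) : Path u x) → vertices w′ ⊆ vertices w
    takeTo here       _            (here refl)  = (here , [] ∷ []) , id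
    takeTo (step r w) _            (here refl)  = (here , [] ∷ []) , λ { (here refl) → here refl }
    takeTo (step r w) (u∉w ∷ uniq) (there x∈w) with takeTo w uniq x∈w
    ... | (w′ , uniq′) , w′⊆w =
      (step r w′ , anti-mono w′⊆w u∉w ∷ uniq′) , λ { (here refl) → here refl ; (there y∈w′) → there (w′⊆w y∈w′) }

    toPath : ∀ {u v} → Walk G R u v → Path u v
    toPath here = here , [] ∷ []
    toPath {u} (step r w) with toPath w
    ... | w′ , uniq with u ∈? vertices w′
    ...   | yes u∈w′ = dropTo w′ uniq u∈w′
    ...   | no  u∉w′ = step r w′ , ¬Any⇒All¬ _ u∉w′ ∷ uniq

    join : ∀ {u v x y} → Walk G R u v → R v x → Walk G R x y → Walk G R u y
    join here         r w′ = step r w′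
    join (step r₀ w) r w′ = step r₀ (join w r w′)

    vertices-join : ∀ {u v x y} (w : Walk G R u v) (r : R v x) (w′ : Walk G R x y) →
                    vertices (join w r w′) ≡ vertices w ++ vertices w′
    vertices-join         here         r w′ = refl
    vertices-join {u} (step _ w) r w′ = cong (u ∷_) (vertices-join w r w′)

    All-vertices : ∀ {Q : Fin p → Set} → (∀ {x y} → R x y → Q y) → ∀ {u v} → Q u →
                   (w : Walk G R u v) → All Q (vertices w)
    All-vertices R⇒Q Qu here       = Qu ∷ []
    All-vertices R⇒Q Qu (step r w) = Qu ∷ All-vertices R⇒Q (R⇒Q r) w

  mapWalk : ∀ {R R′ : Fin p → Fin p → Set} → (∀ {x y} → R x y → R′ x y) →
            ∀ {u v} → Walk G R u v → Walk G R′ u v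
  mapWalk f here       = here
  mapWalk f (step r w) = step (f r) (mapWalk f w)

  vertices-mapWalk : ∀ {R R′ : Fin p → Fin p → Set} (f : ∀ {x y} → R x y → R′ x y) {u v} (w : Walk G R u v) →
                     vertices (mapWalk f w) ≡ vertices w
  vertices-mapWalk f         here       = refl
  vertices-mapWalk f {u} (step r w) = cong (u ∷_) (vertices-mapWalk f w)

  linked-vertices : ∀ {u v x} (w : Walk G (Adj G) u v) → Adj G v x → Linked (Adj G) (vertices w ++ [ x ])
  linked-vertices here                 v~x = v~x ∷ [-]
  linked-vertices (step r here)        v~x = r ∷ v~x ∷ [-]
  linked-vertices (step r (step r′ w)) v~x = r ∷ linked-vertices (step r′ w) v~x

  path⇒cycle : ∀ {u v} (w : Walk G (Adj G) u v) → Unique (vertices w) → 3 ≤ length (vertices w) →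
               Adj G v u → HasCycle G
  path⇒cycle here _ (s≤s ()) _
  path⇒cycle {u} (step r w) uniq (s≤s 2≤len) v~u =
    u , vertices w , 2≤len , uniq , linked-vertices (step r w) v~u

  Leaf : (U : Fin p → Set) → Fin p → Set
  Leaf U y = U y × (∀ {z z′} → Adj G y z → Adj G y z′ → U z → U z′ → z ≡ z′)

  chord⇒cycle : ∀ {h q s y} → Adj G h q → (w : Walk G (Adj G) q s) → Unique (h ∷ vertices w) →
                Adj G h y → y ≢ q → y ∈ vertices w → HasCycle G
  chord⇒cycle h~q w (h∉w ∷ uniq) h~y y≢q y∈w with takeTo w uniq y∈w
  ... | (w′ , uniq′) , w′⊆w =
    path⇒cycle (step h~q w′) (anti-mono w′⊆w h∉w ∷ uniq′)
               (s≤s (2≤length-vertices (y≢q ∘ sym) w′)) (Adj-sym h~y)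

  module _ (acyclic : ¬ HasCycle G) {U : Fin p → Set} (U? : Decidable U) where

    -- Extends the path h q … at h inside U; a path has at most p vertices, so the fuel cannot run out.
    extendPath : (fuel : ℕ) → ∀ {h q s} → Adj G h q → (w : Walk G (Adj G) q s) → Unique (h ∷ vertices w) →
                 U h → p < length (h ∷ vertices w) + fuel → ∃ (Leaf U)
    extendPath zero _ _ uniq _ bound =
      contradiction (unique⇒length≤ uniq) (<⇒≱ (subst (p <_) (+-identityʳ _) bound))
    extendPath (suc fuel) {h} {q} h~q w uniq Uh bound
      with any? (λ y → U? y ×-dec (adj h y Bool.≟ true) ×-dec ¬? (y ≟ q))
    ... | no none = h , Uh , λ h~z h~z′ Uz Uz′ → trans (≡q h~z Uz) (sym (≡q h~z′ Uz′))
      where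
      ≡q : ∀ {z} → Adj G h z → U z → z ≡ q
      ≡q {z} h~z Uz = decidable-stable (z ≟ q) (λ z≢q → none (z , Uz , h~z , z≢q))
    ... | yes (y , Uy , h~y , y≢q) with y ∈? (h ∷ vertices w)
    ...   | no  y∉ = extendPath fuel (Adj-sym h~y) (step h~q w) (¬Any⇒All¬ _ y∉ ∷ uniq) Uy
                       (subst (p <_) (+-suc _ fuel) bound)
    ...   | yes (here refl)  = contradiction h~y Adj-irrefl
    ...   | yes (there y∈w) = contradiction (chord⇒cycle h~q w uniq h~y y≢q y∈w) acyclic

    leaf : ∀ {x} → U x → ∃ (Leaf U)
    leaf {x} Ux with any? (λ y → U? y ×-dec (adj x y Bool.≟ true))
    ... | no none = x , Ux , λ x~z _ Uz _ → contradiction (_ , Uz , x~z) none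
    ... | yes (y , Uy , x~y) =
      extendPath p (Adj-sym x~y) here ((y≢x ∷ []) ∷ [] ∷ []) Uy (<-trans (n<1+n p) (n<1+n (suc p)))
      where
      y≢x : y ≢ x
      y≢x y≡x = Adj-irrefl (subst (Adj G x) y≡x x~y)

  InducedAdj : Subset p → Fin p → Fin p → Set
  InducedAdj S x y = x ∈ₛ S × y ∈ₛ S × Adj G x y

  inducedPath : ∀ {S x y} → InducedConnected G S → x ∈ₛ S → y ∈ₛ S →
                ∃ λ (w : Walk G (Adj G) x y) → Unique (vertices w) × All (_∈ₛ S) (vertices w)
  inducedPath {S} conn x∈S y∈S with toPath (conn _ _ x∈S y∈S)
  ... | w , uniq = mapWalk forget w
                 , subst Unique (sym (vertices-mapWalk forget w)) uniq
                 , subst (All (_∈ₛ S)) (sym (vertices-mapWalk forget w)) (All-vertices (proj₁ ∘ proj₂) x∈S w)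
    where
    forget : ∀ {u v} → InducedAdj S u v → Adj G u v
    forget = proj₂ ∘ proj₂

  crossings⇒cycle : ∀ {S x x′ y y′} → InducedConnected G S → InducedConnected G (∁ S) →
                    x ∈ₛ S → x′ ∈ₛ S → y ∈ₛ ∁ S → y′ ∈ₛ ∁ S → Adj G x y → Adj G x′ y′ →
                    ¬ (x ≡ x′ × y ≡ y′) → HasCycle G
  crossings⇒cycle {x = x} {x′} connS conn∁S x∈S x′∈S y∈∁S y′∈∁S x~y x′~y′ different
    with inducedPath connS x∈S x′∈S | inducedPath conn∁S y′∈∁S y∈∁S
  ... | wS , uniqS , inS | w∁S , uniq∁S , in∁S =
    path⇒cycle (join wS x′~y′ w∁S)
               (subst Unique (sym (vertices-join wS x′~y′ w∁S)) (++⁺ uniqS uniq∁S disjoint))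
               (subst (3 ≤_) (sym (trans (cong length (vertices-join wS x′~y′ w∁S)) (length-++ (vertices wS))))
                      long)
               (Adj-sym x~y)
    where
    disjoint : ∀ {v} → ¬ (v ∈ vertices wS × v ∈ vertices w∁S)
    disjoint (v∈wS , v∈w∁S) = x∈p⇒x∉∁p (All.lookup inS v∈wS) (All.lookup in∁S v∈w∁S)
    long : 3 ≤ length (vertices wS) + length (vertices w∁S)
    long with x ≟ x′
    ... | no  x≢x′ = +-mono-≤ (2≤length-vertices x≢x′ wS) (0<length-vertices w∁S)
    ... | yes x≡x′ =
      +-mono-≤ (0<length-vertices wS) (2≤length-vertices (λ y′≡y → different (x≡x′ , sym y′≡y)) w∁S)

  pairs : List (Fin p × Fin p)
  pairs = cartesianProduct (allFin p) (allFin p)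

  crosses : (Fin p → Bool) → Fin p × Fin p → Bool
  crosses e (u , v) = (toℕ u <ᵇ toℕ v) ∧ adj u v ∧ (e u xor e v)

  cutSize : (Fin p → Bool) → ℕ
  cutSize e = length (filterᵇ (crosses e) pairs)

  crosses⇒ : ∀ {e u v} → T (crosses e (u , v)) → toℕ u < toℕ v × Adj G u v × T (e u xor e v)
  crosses⇒ {u = u} {v} t with Equivalence.to Bool.T-∧ t
  ... | u<v , rest with Equivalence.to Bool.T-∧ rest
  ... | u~v , differ = <ᵇ⇒< (toℕ u) (toℕ v) u<v , Equivalence.to Bool.T-≡ u~v , differ

  cutSize-resp : ∀ {e e′} → (∀ u v → e u xor e v ≡ e′ u xor e′ v) → cutSize e ≡ cutSize e′
  cutSize-resp same =
    length-filterᵇ-cong (λ (u , v) → cong (λ b → (toℕ u <ᵇ toℕ v) ∧ adj u v ∧ b) (same u v)) pairs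

  cutSize-cong : ∀ {e e′} → (∀ v → e v ≡ e′ v) → cutSize e ≡ cutSize e′
  cutSize-cong {e} {e′} e≗e′ = cutSize-resp {e} {e′} (λ u v → cong₂ _xor_ (e≗e′ u) (e≗e′ v))

  cutSize-complement : ∀ e → cutSize (not ∘ e) ≡ cutSize e
  cutSize-complement e = cutSize-resp {not ∘ e} {e} (λ u v → not-xor-not (e u) (e v))

  SameEdge : Fin p × Fin p → Fin p × Fin p → Set
  SameEdge uv xy = uv ≡ xy ⊎ uv ≡ swap xy

  sameEdge-trans : ∀ {uv u′v′ xy} → SameEdge uv xy → SameEdge u′v′ xy → SameEdge uv u′v′
  sameEdge-trans (inj₁ refl) (inj₁ refl) = inj₁ refl
  sameEdge-trans (inj₁ refl) (inj₂ refl) = inj₂ refl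
  sameEdge-trans (inj₂ refl) (inj₁ refl) = inj₂ refl
  sameEdge-trans (inj₂ refl) (inj₂ refl) = inj₁ refl

  length-filter-pairs≤1 : (P : Fin p × Fin p → Bool) → (∀ {u v} → T (P (u , v)) → toℕ u < toℕ v) →
                          (∀ {uv u′v′} → T (P uv) → T (P u′v′) → SameEdge uv u′v′) →
                          length (filterᵇ P pairs) ≤ 1
  length-filter-pairs≤1 P increasing sameEdge =
    length-filterᵇ≤1 P (cartesianProduct⁺ (allFin⁺ p) (allFin⁺ p)) same
    where
    same : ∀ {uv u′v′} → T (P uv) → T (P u′v′) → uv ≡ u′v′
    same Puv Pu′v′ with sameEdge Puv Pu′v′
    ... | inj₁ uv≡u′v′ = uv≡u′v′
    ... | inj₂ refl    = contradiction (increasing Pu′v′) (<-asym (increasing Puv))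

  crossingEdge : ∀ {S uv} → T (crosses (lookup S) uv) →
                 ∃₂ λ x y → x ∈ₛ S × y ∈ₛ ∁ S × Adj G x y × SameEdge uv (x , y)
  crossingEdge {S} {u , v} t with crosses⇒ {lookup S} t
  ... | _ , u~v , differ with T-xor differ
  ... | inj₁ (Su , Sv) = u , v , lookup≡true⇒∈ S Su , lookup≡false⇒∈∁ S Sv , u~v , inj₁ refl
  ... | inj₂ (Su , Sv) = v , u , lookup≡true⇒∈ S Sv , lookup≡false⇒∈∁ S Su , Adj-sym u~v , inj₂ refl

  cutSize-partition≤1 : ¬ HasCycle G → ∀ {S} → ConnectedPartition G S → cutSize (lookup S) ≤ 1
  cutSize-partition≤1 acyclic {S} (_ , _ , connS , conn∁S) =
    length-filter-pairs≤1 (crosses (lookup S)) (proj₁ ∘ crosses⇒ {lookup S}) same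
    where
    same : ∀ {uv u′v′} → T (crosses (lookup S) uv) → T (crosses (lookup S) u′v′) → SameEdge uv u′v′
    same t t′ with crossingEdge {S} t | crossingEdge {S} t′
    ... | x , y , x∈S , y∈∁S , x~y , uv≈xy | x′ , y′ , x′∈S , y′∈∁S , x′~y′ , u′v′≈x′y′
      with x ≟ x′ ×-dec y ≟ y′
    ... | yes (refl , refl) = sameEdge-trans uv≈xy u′v′≈x′y′
    ... | no  different     =
      contradiction (crossings⇒cycle connS conn∁S x∈S x′∈S y∈∁S y′∈∁S x~y x′~y′ different) acyclic

  crosses-insert : ∀ {e y u v} → u ≢ y → v ≢ y → crosses (insert y e) (u , v) ≡ crosses e (u , v)
  crosses-insert {e} {u = u} {v} u≢y v≢y =
    cong₂ (λ a b → (toℕ u <ᵇ toℕ v) ∧ adj u v ∧ (a xor b)) (insert-≢ e u≢y) (insert-≢ e v≢y)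

  newCrossing⇒edgeAt : ∀ {e y uv} → T (crosses (insert y e) uv) → ¬ T (crosses e uv) →
                       ∃ λ z → e z ≡ false × Adj G y z × SameEdge uv (y , z)
  newCrossing⇒edgeAt {e} {y} {u , v} new old with u ≟ y | v ≟ y | crosses⇒ {insert y e} new
  ... | yes refl | yes refl | u<u , _ , _ = contradiction u<u (<-irrefl refl)
  ... | yes refl | no v≢y | _ , u~v , differ =
    v , trans (sym (insert-≢ e v≢y)) (T-true-xor (insert-self y e) differ) , u~v , inj₁ refl
  ... | no u≢y | yes refl | _ , u~v , differ =
    u , trans (sym (insert-≢ e u≢y)) (T-true-xor (insert-self y e) (subst T (Bool.xor-comm (insert y e u) _) differ))
      , Adj-sym u~v , inj₂ refl
  ... | no u≢y | no v≢y | _ = contradiction (subst T (crosses-insert u≢y v≢y) new) old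

  cutSize-insertLeaf : ∀ {e y} → Leaf (λ v → e v ≡ false) y → cutSize (insert y e) ≤ cutSize e + 1
  cutSize-insertLeaf {e} {y} (_ , unique-neighbour) =
    ≤-trans (length-filterᵇ≤ (crosses (insert y e)) (crosses e) pairs)
            (+-monoʳ-≤ (cutSize e)
              (length-filter-pairs≤1 _ (proj₁ ∘ crosses⇒ {insert y e} ∘ proj₁ ∘ T-∧-not) same))
    where
    same : ∀ {uv u′v′} → T (crosses (insert y e) uv ∧ not (crosses e uv)) →
           T (crosses (insert y e) u′v′ ∧ not (crosses e u′v′)) → SameEdge uv u′v′
    same t t′ with T-∧-not t | T-∧-not t′
    ... | new , old | new′ , old′ with newCrossing⇒edgeAt {e} new old | newCrossing⇒edgeAt {e} new′ old′
    ... | z , ez , y~z , uv≈yz | z′ , ez′ , y~z′ , u′v′≈yz′ with unique-neighbour y~z y~z′ ez ez′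
    ... | refl = sameEdge-trans uv≈yz u′v′≈yz′

  module _ (acyclic : ¬ HasCycle G) where

    -- Each step colours a leaf of the forest spanned by the uncoloured vertices.
    grow : ∀ k e → count e + k ≤ p → ∃ λ e′ → count e′ ≡ count e + k × cutSize e′ ≤ cutSize e + k
    grow zero    e _     = e , sym (+-identityʳ _) , ≤-reflexive (sym (+-identityʳ _))
    grow (suc k) e bound
      with leaf acyclic (λ v → e v Bool.≟ false)
                (proj₂ (count<n⇒∃false e (<-≤-trans (m<m+n (count e) (s≤s z≤n)) bound)))
    ... | y , leafy@(ey , _)
      with grow k (insert y e)
                (subst (_≤ p) (trans (+-suc (count e) k) (cong (_+ k) (sym (count-insert y e ey)))) bound)
    ... | e′ , count-e′ , cut-e′ =
      e′ , trans count-e′ (trans (cong (_+ k) (count-insert y e ey)) (sym (+-suc (count e) k)))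
         , ≤-trans cut-e′ (≤-trans (+-monoˡ-≤ k (cutSize-insertLeaf leafy))
                                   (≤-reflexive (+-assoc (cutSize e) 1 k)))

    smallerSide : (S : Subset p) → ∃ λ e → count e ≡ ∣ S ∣ ⊓ ∣ ∁ S ∣ × cutSize e ≡ cutSize (lookup S)
    smallerSide S with ≤-total ∣ S ∣ ∣ ∁ S ∣
    ... | inj₁ S≤∁S = lookup S , trans (count-lookup S) (sym (m≤n⇒m⊓n≡m S≤∁S)) , refl
    ... | inj₂ ∁S≤S = lookup (∁ S) , trans (count-lookup (∁ S)) (sym (m≥n⇒m⊓n≡n ∁S≤S))
                    , trans (cutSize-cong (λ v → lookup-map v not S)) (cutSize-complement (lookup S))

    balancedColouring : ∀ {S} → ConnectedPartition G S →
                        ∃ λ e → count e ≡ ⌊ p /2⌋ × cutSize e ≤ ⌊ ∣ ∣ S ∣ - ∣ ∁ S ∣ ∣ /2⌋ + 1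
    balancedColouring {S} partition =
      let (e₀ , count-e₀ , cut-e₀) = smallerSide S
          (e , count-e , cut-e)    = grow k e₀ (subst (_≤ p) (sym (balanced count-e₀)) (⌊n/2⌋≤n p))
          cut-e₀≤1 = subst (_≤ 1) (sym cut-e₀) (cutSize-partition≤1 acyclic partition)
      in e , trans count-e (balanced count-e₀)
           , ≤-trans cut-e (≤-trans (+-monoˡ-≤ k cut-e₀≤1) (≤-reflexive (+-comm 1 k)))
      where
      k : ℕ
      k = ⌊ ∣ ∣ S ∣ - ∣ ∁ S ∣ ∣ /2⌋
      balanced : ∀ {m} → m ≡ ∣ S ∣ ⊓ ∣ ∁ S ∣ → m + k ≡ ⌊ p /2⌋
      balanced refl = trans (⊓+⌊∣-∣/2⌋≡⌊+/2⌋ ∣ S ∣ ∣ ∁ S ∣) (cong ⌊_/2⌋ (∣S∣+∣∁S∣≡n S))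

  count-odd : ∀ n → count (λ (i : Fin n) → odd G (toℕ i)) ≡ ⌊ n /2⌋
  count-odd zero          = refl
  count-odd (suc zero)    = refl
  count-odd (suc (suc n)) =
    cong suc (trans (count-cong {n} {not ∘ not ∘ odd G ∘ toℕ} (Bool.not-involutive ∘ odd G ∘ toℕ))
                    (count-odd n))

  negEdges≡cutSize : ∀ π → negEdges G π ≡ cutSize (λ v → odd G (label G π v))
  negEdges≡cutSize π = length-filterᵇ-cong
    (λ (u , v) → cong (λ b → (toℕ u <ᵇ toℕ v) ∧ adj u v ∧ b)
                      (if-not≡xor (odd G (label G π u)) (odd G (label G π v))))
    pairs

  -- The label 1 + toℕ (π v) is even iff toℕ (π v) is odd, which happens for ⌊ p /2⌋ vertices.
  labelling : ∀ e → count e ≡ ⌊ p /2⌋ → ∃ λ π → negEdges G π ≡ cutSize e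
  labelling e count-e with sameCount⇒permutation (λ i → odd G (toℕ i)) e (trans (count-odd p) (sym count-e))
  ... | π , odd≡e = π , (begin
    negEdges G π                         ≡⟨ negEdges≡cutSize π ⟩
    cutSize (λ v → odd G (label G π v))  ≡⟨ cutSize-cong (λ v → cong not (odd≡e v)) ⟩
    cutSize (not ∘ e)                    ≡⟨ cutSize-complement e ⟩
    cutSize e                            ∎)
    where open ≡-Reasoning

mainTheorem2 : ∀ (n : ℕ) (T : Graph (suc n)) → 1 ≤ n → IsTree T →
    ∀ (s c : ℕ) → IsRna T s → IsC T c → s ≤ c / 2 + 1
mainTheorem2 n T _ (_ , acyclic) s c (_ , s-minimal) ((S , partition , ∣S-∁S∣≡c) , _) =
  let (e , count-e , cut-e)       = balancedColouring T acyclic partition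
      (π , negEdges≡cutSize-e)    = labelling T e count-e
  in begin
    s                             ≤⟨ s-minimal π ⟩
    negEdges T π                  ≡⟨ negEdges≡cutSize-e ⟩
    cutSize T e                   ≤⟨ cut-e ⟩
    ⌊ ∣ ∣ S ∣ - ∣ ∁ S ∣ ∣ /2⌋ + 1 ≡⟨ cong (λ d → ⌊ d /2⌋ + 1) ∣S-∁S∣≡c ⟩
    ⌊ c /2⌋ + 1                   ≡⟨ cong (_+ 1) (⌊n/2⌋≡n/2 c) ⟩
    c / 2 + 1                     ∎
  where open ≤-Reasoning
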